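{- For every secondarily reflexive model $\mathcal{M}=(S,R,V)$ there exists a Euclidean model $\mathcal{M}'=(S,R',V)$ (same domain and valuation) such that for all $s\in S$ and all $\phi\in\mathcal{L}(W)$, $\mathcal{M},s\vDash\phi$ iff $\mathcal{M}',s\vDash\phi$.
   Context: Fix a nonempty set $\mathbf{P}$ of propositional variables. $\mathcal{L}(W)$: $\phi::=p\mid\neg\phi\mid(\phi\land\phi)\mid W\phi$ ($p\in\mathbf{P}$). A model is $(S,R,V)$ with $S\neq\emptyset$, $R\subseteq S\times S$, $V:\mathbf{P}\to2^S$. Truth: Boolean clauses as usual; $\mathcal{M},s\vDash W\phi$ iff $\mathcal{M},s\nvDash\phi$ and $\mathcal{M},t\vDash\phi$ for all $t$ with $sRt$. A model is secondarily reflexive if $sRt$ implies $tRt$ for all $s,t$; it is Euclidean if $sRt$ and $sRu$ imply $tRu$. -}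

module Defs where

open import Level using (Level; suc; _⊔_)
open import Data.Product using (_×_)
open import Relation.Nullary using (¬_)

data Form (Prop : Set) : Set where
  var  : Prop → Form Prop
  neg  : Form Prop → Form Prop
  and  : Form Prop → Form Prop → Form Prop
  W    : Form Prop → Form Prop

record Model (Prop : Set) : Set₁ where
  field
    S    : Set
    inh  : S
    R    : S → S → Set
    V    : Prop → S → Set  -- V p = the set of states where p holds

_,_⊨_ : {Prop : Set} → (M : Model Prop) → Model.S M → Form Prop → Set
M , s ⊨ var p   = Model.V M p s
M , s ⊨ neg φ   = ¬ (M , s ⊨ φ)
M , s ⊨ and φ ψ = (M , s ⊨ φ) × (M , s ⊨ ψ)
M , s ⊨ W φ     = ¬ (M , s ⊨ φ) × (∀ t → Model.R M s t → M , t ⊨ φ)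

SecondarilyReflexive : {Prop : Set} → Model Prop → Set
SecondarilyReflexive M = ∀ s t → Model.R M s t → Model.R M t t

Euclidean : {Prop : Set} → Model Prop → Set
Euclidean M = ∀ s t u → Model.R M s t → Model.R M s u → Model.R M t u

withRel : {Prop : Set} → (M : Model Prop) → (Model.S M → Model.S M → Set) → Model Prop
withRel M R' = record { S = Model.S M ; inh = Model.inh M ; R = R' ; V = Model.V M }

-- W φ is false at every reflexive state, since it requires ¬ φ at s but φ at all successors of s.
-- Hence adding edges out of reflexive states changes no truth value of L(W). So join every two
-- reflexive states by an edge; the result is Euclidean because, by secondary reflexivity, the
-- target of every edge of the new relation is reflexive.
module Submission where

open import Defs
open import Data.Product using (Σ; _×_; _,_)
open import Data.Sum using (_⊎_; inj₁; inj₂)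
open import Data.Empty using (⊥-elim)
open import Function.Bundles using (_⇔_; mk⇔)
open import Relation.Nullary using (¬_)

module _ {Prop : Set} (M : Model Prop) where
  open Model M

  W-false-at-reflexive : ∀ {s} φ → R s s → ¬ (M , s ⊨ W φ)
  W-false-at-reflexive φ Rss (¬φ , □φ) = ¬φ (□φ _ Rss)

  module _ (R' : S → S → Set)
           (R⊆R' : ∀ {s t} → R s t → R' s t)
           (R'⊆R∪refl : ∀ {s t} → R' s t → R s t ⊎ R s s) where

    ⊨-preserved : ∀ φ s → M , s ⊨ φ → withRel M R' , s ⊨ φ
    ⊨-reflected : ∀ φ s → withRel M R' , s ⊨ φ → M , s ⊨ φ
    ⊨-preserved (var p)   s h       = h
    ⊨-preserved (neg φ)   s h       = λ h' → h (⊨-reflected φ s h')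
    ⊨-preserved (and φ ψ) s (a , b) = ⊨-preserved φ s a , ⊨-preserved ψ s b
    ⊨-preserved (W φ)     s (¬φ , □φ) =
      (λ h → ¬φ (⊨-reflected φ s h)) , λ t R'st → successor-case t (R'⊆R∪refl R'st)
      where
      successor-case : ∀ t → R s t ⊎ R s s → withRel M R' , t ⊨ φ
      successor-case t (inj₁ Rst) = ⊨-preserved φ t (□φ t Rst)
      successor-case t (inj₂ Rss) = ⊥-elim (W-false-at-reflexive φ Rss (¬φ , □φ))
    ⊨-reflected (var p)   s h       = h
    ⊨-reflected (neg φ)   s h       = λ h' → h (⊨-preserved φ s h')
    ⊨-reflected (and φ ψ) s (a , b) = ⊨-reflected φ s a , ⊨-reflected ψ s b
    ⊨-reflected (W φ)     s (¬φ , □φ) =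
      (λ h → ¬φ (⊨-preserved φ s h)) , λ t Rst → ⊨-reflected φ t (□φ t (R⊆R' Rst))

  reflexiveCompletion : S → S → Set
  reflexiveCompletion s t = R s t ⊎ (R s s × R t t)

  reflexiveCompletion⊆R∪refl : ∀ {s t} → reflexiveCompletion s t → R s t ⊎ R s s
  reflexiveCompletion⊆R∪refl (inj₁ Rst)       = inj₁ Rst
  reflexiveCompletion⊆R∪refl (inj₂ (Rss , _)) = inj₂ Rss

  module _ (sr : SecondarilyReflexive M) where

    reflexiveCompletion-target-reflexive : ∀ {s t} → reflexiveCompletion s t → R t t
    reflexiveCompletion-target-reflexive (inj₁ Rst)      = sr _ _ Rst
    reflexiveCompletion-target-reflexive (inj₂ (_ , Rtt)) = Rtt

    reflexiveCompletion-euclidean : Euclidean (withRel M reflexiveCompletion)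
    reflexiveCompletion-euclidean _ _ _ Est Esu =
      inj₂ (reflexiveCompletion-target-reflexive Est , reflexiveCompletion-target-reflexive Esu)

mainTheorem16 : (Prop : Set) → Prop → (M : Model Prop) → SecondarilyReflexive M →
    Σ (Model.S M → Model.S M → Set) (λ R' →
    Euclidean (withRel M R') ×
    (∀ (s : Model.S M) (φ : Form Prop) → (M , s ⊨ φ) ⇔ (withRel M R' , s ⊨ φ)))
mainTheorem16 _ _ M sr =
  E , reflexiveCompletion-euclidean M sr ,
  λ s φ → mk⇔ (⊨-preserved M E inj₁ (reflexiveCompletion⊆R∪refl M) φ s)
              (⊨-reflected M E inj₁ (reflexiveCompletion⊆R∪refl M) φ s)
  where
  E : Model.S M → Model.S M → Set
  E = reflexiveCompletion M
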